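{- If $G$ is a graph with at least two vertices and $p>{\rm rad}(G)$ is a positive integer, then $G^{[\natural p]}$ is not connected.
   Context: For a graph $G$ and a positive integer $p$, $G^{[\natural p]}$ is the graph on $V(G)$ in which two vertices are adjacent iff their distance in $G$ is exactly $p$. The eccentricity of a vertex is its maximum distance to other vertices; ${\rm rad}(G)$ is the minimum eccentricity over all vertices. -}

module Defs where

open import Data.Nat using (ℕ; zero; suc; _≤_; _<_)
open import Data.Fin using (Fin)
open import Data.Product using (Σ; ∃; _×_; _,_)
open import Relation.Binary.PropositionalEquality using (_≡_)
open import Relation.Nullary using (¬_)

record Graph (n : ℕ) : Set₁ where
  field
    Adj   : Fin n → Fin n → Set
    sym   : ∀ {u v} → Adj u v → Adj v u
    irrefl : ∀ {u} → ¬ Adj u u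

data Walk {n : ℕ} (R : Fin n → Fin n → Set) : Fin n → Fin n → ℕ → Set where
  [] : ∀ {u} → Walk R u u zero
  _∷_ : ∀ {u v w k} → R u v → Walk R v w k → Walk R u w (suc k)

module _ {n : ℕ} (G : Graph n) where
  open Graph G

  Dist : Fin n → Fin n → ℕ → Set
  Dist u v k = Walk Adj u v k × (∀ m → m < k → ¬ Walk Adj u v m)

  Ecc : Fin n → ℕ → Set
  Ecc v e = (∀ u → Σ ℕ λ k → Dist v u k × k ≤ e) × (Σ (Fin n) λ u → Dist v u e)

  Rad : ℕ → Set
  Rad r = (Σ (Fin n) λ v → Ecc v r) × (∀ v e → Ecc v e → r ≤ e)

  ExactDistAdj : ℕ → Fin n → Fin n → Set
  ExactDistAdj p u v = Dist u v p

Connected : {n : ℕ} → (Fin n → Fin n → Set) → Set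
Connected {n} R = ∀ (u v : Fin n) → ∃ λ k → Walk R u v k

-- Let v be a centre of G. Every vertex lies within distance rad(G) < p of v,
-- so v has no neighbour in G^[♮p]; but in a connected graph on at least two
-- vertices every vertex has a neighbour.
module Submission where

open import Defs
open import Data.Nat using (ℕ; _≤_; _<_; z≤n; s≤s; suc)
open import Data.Nat.Properties using (≤-<-trans)
open import Data.Fin using (Fin; zero; suc)
open import Data.Product using (_,_; ∃)
open import Relation.Nullary using (¬_)

Isolated : {n : ℕ} → (Fin n → Fin n → Set) → Fin n → Set
Isolated R v = ∀ w → ¬ R v w

other : ∀ {m} → Fin (suc (suc m)) → Fin (suc (suc m))
other zero    = suc zero
other (suc _) = zero

walk-to-other⇒neighbour : ∀ {m} {R : Fin (suc (suc m)) → Fin (suc (suc m)) → Set}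
  (v : Fin (suc (suc m))) {k} → Walk R v (other v) k → ∃ λ w → R v w
walk-to-other⇒neighbour zero    (e ∷ _) = _ , e
walk-to-other⇒neighbour (suc _) (e ∷ _) = _ , e

connected⇒¬isolated : ∀ {n} {R : Fin n → Fin n → Set} → 2 ≤ n →
  Connected R → ∀ v → ¬ Isolated R v
connected⇒¬isolated (s≤s (s≤s z≤n)) conn v isolated
  with conn v (other v)
... | _ , walk with walk-to-other⇒neighbour v walk
... | w , e = isolated w e

module _ {n : ℕ} (G : Graph n) where

  walk-shorter⇒¬Dist : ∀ {u v k p} → k < p → Walk (Graph.Adj G) u v k → ¬ Dist G u v p
  walk-shorter⇒¬Dist k<p walk (_ , noShorter) = noShorter _ k<p walk

  ecc<p⇒isolated : ∀ {v e p} → Ecc G v e → e < p → Isolated (ExactDistAdj G p) v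
  ecc<p⇒isolated (within , _) e<p w with within w
  ... | k , (walk , _) , k≤e = walk-shorter⇒¬Dist (≤-<-trans k≤e e<p) walk

lemma3p1 : ∀ {n : ℕ} (G : Graph n) (p r : ℕ) → 2 ≤ n → 1 ≤ p →
    Rad G r → r < p → ¬ Connected (ExactDistAdj G p)
lemma3p1 G p r 2≤n _ ((centre , eccCentre) , _) r<p conn =
  connected⇒¬isolated 2≤n conn centre (ecc<p⇒isolated G eccCentre r<p)
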